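{- Let $q$ be a prime power, $s\ge 2$, and let the bases $\mathfrak{B}_{m,i}$, the maps $\theta_m$, the set $Y$ and the reductions $\boldsymbol{\alpha}^{(m)}$ be as in the context. For $\boldsymbol{\alpha}\in Y^s$ and $m\in\mathbb{N}$ let $\mathcal{N}'_{\boldsymbol{\alpha}^{(m)}}=\{\mathbf{k}\in R_m^s:\ \boldsymbol{\alpha}^{(m)}\cdot\mathbf{k}\equiv 0\pmod{x^m}\}$ and $\mathcal{N}_{\boldsymbol{\alpha}^{(m)}}=\theta_m(\mathcal{N}'_{\boldsymbol{\alpha}^{(m)}})\subseteq\mathbb{F}_q^{sm}$. Then the sequence $(\mathcal{N}_{\boldsymbol{\alpha}^{(m)}})_{m\ge1}$ is a dual space chain.
   Context: $\mathbb{F}_q$ is the finite field with $q$ elements. For $m\in\mathbb{N}$, $R_m:=\mathbb{F}_q[x]/(x^m)$, whose elements are identified with polynomials of degree $<m$. For each $i=1,\ldots,s$ and each $m\in\mathbb{N}$ an ordered basis $\mathfrak{B}_{m,i}=\{\mathfrak{b}_{m,i,1},\ldots,\mathfrak{b}_{m,i,m}\}$ of $R_m$ over $\mathbb{F}_q$ is fixed such that for all $1\le j\le m$ the coefficient vector of $\mathfrak{b}_{m+1,i,j}$ with respect to $\{1,x,\ldots,x^m\}$ equals the coefficient vector of $\mathfrak{b}_{m,i,j}$ with respect to $\{1,x,\ldots,x^{m-1}\}$ with a $0$ appended. The map $\theta_m:R_m^s\to\mathbb{F}_q^{sm}$ sends $(k_1,\ldots,k_s)$ to the concatenation of the coordinate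 vectors of $k_1,\ldots,k_s$ with respect to $\mathfrak{B}_{m,1},\ldots,\mathfrak{B}_{m,s}$ respectively. $Y=\{\alpha\in\mathbb{F}_q[[x]]:\ \gcd(\alpha\bmod x^m,x^m)=1 \text{ for all } m\in\mathbb{N}\}$, and for $\boldsymbol{\alpha}\in Y^s$, $\boldsymbol{\alpha}^{(m)}\in R_m^s$ is the coordinatewise reduction of $\boldsymbol{\alpha}$ modulo $x^m$; $\boldsymbol{\alpha}^{(m)}\cdot\mathbf{k}=\sum_i\alpha_i^{(m)}k_i$. Dual space chain: for each $m\in\mathbb{N}$ let $\mathcal{N}_m$ be an $\mathbb{F}_q$-linear subspace of $\mathbb{F}_q^{sm}$ with codimension at most $m$. Let $\mathcal{N}_{m+1,m}=\{(\mathbf{a}_1,\ldots,\mathbf{a}_s)\in\mathbb{F}_q^{sm}:\ \mathbf{a}_i\in\mathbb{F}_q^m,\ ((\mathbf{a}_1,0),\ldots,(\mathbf{a}_s,0))\in\mathcal{N}_{m+1}\}$. If for all $m$, $\mathcal{N}_{m+1,m}$ is a subspace of $\mathcal{N}_m$ with $\dim(\mathcal{N}_m/\mathcal{N}_{m+1,m})\le 1$, then $(\mathcal{N}_m)_{m\ge1}$ is called a dual space chain. -}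

module Defs where

open import Level using (0ℓ)
open import Algebra.Bundles using (CommutativeRing)
open import Data.Nat using (ℕ; zero; suc; _∸_; _<?_; _≤_)
open import Data.Fin using (Fin; zero; suc; toℕ; fromℕ<)
open import Data.Product using (Σ; ∃; _×_; _,_)
open import Data.Unit using (⊤)
open import Relation.Nullary using (¬_; yes; no)
open import Relation.Binary.PropositionalEquality using (_≡_)

record FiniteField (q : ℕ) : Set₁ where
  field
    commRing : CommutativeRing 0ℓ 0ℓ
  open CommutativeRing commRing public using (Carrier; _≈_; _+_; _*_; _-_; -_; 0#; 1#)
  field
    nontrivial : ¬ (1# ≈ 0#)
    inverse    : ∀ x → ¬ (x ≈ 0#) → ∃ λ y → y * x ≈ 1#
    enum       : Fin q → Carrier
    enum-surj  : ∀ x → ∃ λ i → enum i ≈ x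
    enum-inj   : ∀ i j → enum i ≈ enum j → i ≡ j

module _ {q : ℕ} (F : FiniteField q) where
  open FiniteField F using (Carrier; _≈_; _+_; _*_; _-_; 0#; 1#)

  ∑ : {n : ℕ} → (Fin n → Carrier) → Carrier
  ∑ {zero}  f = 0#
  ∑ {suc n} f = f zero + ∑ (λ j → f (suc j))

  ∑ℕ : ℕ → (ℕ → Carrier) → Carrier
  ∑ℕ zero    f = 0#
  ∑ℕ (suc n) f = f zero + ∑ℕ n (λ i → f (suc i))

  -- R_m = F_q[x]/(x^m), elements = coefficient vectors (c_0,...,c_{m-1})
  Poly : ℕ → Set
  Poly m = Fin m → Carrier

  _≋_ : {m : ℕ} → Poly m → Poly m → Set
  f ≋ g = ∀ t → f t ≈ g t

  zeroP : {m : ℕ} → Poly m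
  zeroP t = 0#

  oneP : {m : ℕ} → Poly m
  oneP zero    = 1#
  oneP (suc t) = 0#

  addP : {m : ℕ} → Poly m → Poly m → Poly m
  addP f g t = f t + g t

  coeff : {m : ℕ} → Poly m → ℕ → Carrier
  coeff {m} f n with n <? m
  ... | yes n<m = f (fromℕ< n<m)
  ... | no  _   = 0#

  mulP : {m : ℕ} → Poly m → Poly m → Poly m
  mulP f g k = ∑ℕ (suc (toℕ k)) (λ i → coeff f i * coeff g (toℕ k ∸ i))

  -- power series α ∈ F_q[[x]] given by its coefficient sequence
  PowerSeries : Set
  PowerSeries = ℕ → Carrier

  red : (m : ℕ) → PowerSeries → Poly m
  red m α k = α (toℕ k)

  -- gcd(α mod x^m, x^m) = 1, in Bezout form: u·(α mod x^m) + v·x^m = 1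
  -- for some polynomials u, v, i.e. u·(α mod x^m) ≡ 1 (mod x^m).
  InY : PowerSeries → Set
  InY α = ∀ (m : ℕ) → ∃ λ (u : Poly m) → mulP u (red m α) ≋ oneP

  lincomb : {m n : ℕ} → (Fin n → Carrier) → (Fin n → Poly m) → Poly m
  lincomb c b t = ∑ (λ j → c j * b j t)

  IsBasis : {m : ℕ} → (Fin m → Poly m) → Set
  IsBasis {m} b =
    (∀ (k : Poly m) → ∃ λ (c : Fin m → Carrier) → lincomb c b ≋ k)
    × (∀ (c : Fin m → Carrier) → lincomb c b ≋ zeroP → ∀ j → c j ≈ 0#)

  -- append a 0 coordinate
  pad : {m : ℕ} → (Fin m → Carrier) → Fin (suc m) → Carrier
  pad {zero}  a zero    = 0#
  pad {suc m} a zero    = a zero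
  pad {suc m} a (suc t) = pad (λ j → a (suc j)) t

  inj₁F : {m : ℕ} → Fin m → Fin (suc m)
  inj₁F zero    = zero
  inj₁F (suc j) = suc (inj₁F j)

  -- Families of bases B m i j = 𝔟_{m,i,j+1}
  BasisFamily : ℕ → Set
  BasisFamily s = (m : ℕ) → Fin s → Fin m → Poly m

  AdmissibleBases : {s : ℕ} → BasisFamily s → Set
  AdmissibleBases {s} B =
    (∀ m (i : Fin s) → IsBasis (B m i))
    × (∀ m (i : Fin s) (j : Fin m) → ∀ t → B (suc m) i (inj₁F j) t ≈ pad (B m i j) t)

  -- vectors of F_q^{sm}, written as s blocks of length m
  -- (block i = coordinates with respect to 𝔅_{m,i})
  Vect : ℕ → ℕ → Set
  Vect s m = Fin s → Fin m → Carrier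

  _≋V_ : {s m : ℕ} → Vect s m → Vect s m → Set
  v ≋V w = ∀ i t → v i t ≈ w i t

  zeroV : {s m : ℕ} → Vect s m
  zeroV i t = 0#

  _⊕_ : {s m : ℕ} → Vect s m → Vect s m → Vect s m
  (v ⊕ w) i t = v i t + w i t

  _⊙_ : {s m : ℕ} → Carrier → Vect s m → Vect s m
  (a ⊙ v) i t = a * v i t

  _⊖_ : {s m : ℕ} → Vect s m → Vect s m → Vect s m
  (v ⊖ w) i t = v i t - w i t

  ∑V : {s m d : ℕ} → (Fin d → Vect s m) → Vect s m
  ∑V {d = zero}  w = zeroV
  ∑V {d = suc d} w = w zero ⊕ ∑V (λ j → w (suc j))

  Subset : ℕ → ℕ → Set₁
  Subset s m = Vect s m → Set

  IsSubspace : {s m : ℕ} → Subset s m → Set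
  IsSubspace V =
    (∀ v w → v ≋V w → V v → V w)
    × V zeroV
    × (∀ v w → V v → V w → V (v ⊕ w))
    × (∀ a v → V v → V (a ⊙ v))

  -- dim(V / W) ≤ d : V/W is spanned by (the classes of) d vectors of V
  QuotDim≤ : {s m : ℕ} → Subset s m → Subset s m → ℕ → Set
  QuotDim≤ {s} {m} V W d =
    Σ (Fin d → Vect s m) λ w →
      (∀ j → V (w j))
      × (∀ v → V v → ∃ λ (c : Fin d → Carrier) → W (v ⊖ ∑V (λ j → c j ⊙ w j)))

  _⊆_ : {s m : ℕ} → Subset s m → Subset s m → Set
  V ⊆ W = ∀ v → V v → W v

  restrict : {s m : ℕ} → Subset s (suc m) → Subset s m
  restrict N a = N (λ i → pad (a i))

  -- dual space chain (indices m ≥ 1, N (suc m) = 𝒩_{m+1}); N zero unused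
  IsDualSpaceChain : {s : ℕ} → ((m : ℕ) → Subset s m) → Set
  IsDualSpaceChain N = ∀ (m : ℕ) →
    IsSubspace (N (suc m))
    × QuotDim≤ (λ _ → ⊤) (N (suc m)) (suc m)
    × restrict (N (suc (suc m))) ⊆ N (suc m)
    × QuotDim≤ (N (suc m)) (restrict (N (suc (suc m)))) 1

  dotP : {s : ℕ} (m : ℕ) → (Fin s → PowerSeries) → (Fin s → Poly m) → Poly m
  dotP m α k t = ∑ (λ i → mulP (red m (α i)) (k i) t)

  -- θ_m(k) = v : each block v_i is the coordinate vector of k_i w.r.t. 𝔅_{m,i}
  θ≡ : {s : ℕ} → BasisFamily s → (m : ℕ) → (Fin s → Poly m) → Vect s m → Set
  θ≡ B m k v = ∀ i → lincomb (v i) (B m i) ≋ k i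

  𝒩 : {s : ℕ} → BasisFamily s → (Fin s → PowerSeries) → (m : ℕ) → Subset s m
  𝒩 {s} B α m v = ∃ λ (k : Fin s → Poly m) → (dotP m α k ≋ zeroP) × θ≡ B m k v

{-# OPTIONS --safe #-}
-- For n < m, the coefficient of xⁿ in α·k is a linear functional of θ_m(k): pairing with
-- the vector of coefficients of xⁿ in the products αᵢ·𝔟_{m,i,j}.  So 𝒩_{α^{(m)}} is the joint
-- kernel of m functionals, and by the compatibility of the bases, padding with zeros turns the
-- functionals at level m+1 into those at level m, so 𝒩_{m+1,m} is the kernel of one more
-- functional on 𝒩_{α^{(m)}}.  Each functional lowers the dimension by at most one; deciding
-- whether it vanishes on a subspace is an exhaustive search over the finite field.
module Submission where

open import Defs
open import Algebra.Bundles using (CommutativeRing)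
open import Data.Fin using (Fin; zero; suc; toℕ; fromℕ<; _≟_)
open import Data.Fin.Properties using (toℕ-fromℕ<; toℕ<n; toℕ-injective; any?)
open import Data.Nat using (ℕ; zero; suc; _≤_; _<_; _∸_; _<?_)
open import Data.Nat.Properties using (≤-<-trans; m∸n≤m; m<n⇒m<1+n; m<1+n⇒m<n∨m≡n; ≤-pred; allUpTo?)
open import Data.Product using (∃; _×_; _,_; proj₁)
open import Data.Sum using (inj₁; inj₂)
open import Data.Unit using (⊤; tt)
open import Data.Empty using (⊥-elim)
open import Data.Vec.Functional using (_∷_)
open import Function using (id; _∘_)
open import Relation.Nullary using (¬_; Dec; yes; no)
open import Relation.Nullary.Decidable using (¬?; _×-dec_; decidable-stable)
open import Relation.Unary using (Decidable)
open import Relation.Binary.PropositionalEquality as ≡ using (_≡_)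
import Algebra.Properties.Ring as RingProperties
import Algebra.Properties.AbelianGroup as AbelianGroupProperties
import Algebra.Properties.CommutativeSemigroup as CommutativeSemigroupProperties
import Algebra.Properties.Semiring.Sum as SemiringSum
import Relation.Binary.Reasoning.Setoid as SetoidReasoning

module Over {q : ℕ} (F : FiniteField q) where
  open FiniteField F
  open CommutativeRing commRing
    using (setoid; refl; sym; trans; reflexive; +-cong; +-congˡ; *-cong; *-congˡ; *-congʳ;
           +-identityʳ; *-identityʳ; zeroˡ; zeroʳ; +-assoc; +-comm; *-assoc; distribʳ; -‿cong; -‿inverseʳ;
           ring; semiring; +-abelianGroup; *-commutativeSemigroup)
  open RingProperties ring using (-1*x≈-x)
  open AbelianGroupProperties +-abelianGroup using (⁻¹-∙-comm)
  open CommutativeSemigroupProperties *-commutativeSemigroup using (x∙yz≈y∙xz)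
  open SemiringSum semiring using (sum; sum-cong-≋; ∑-distrib-+; ∑-comm; *-distribˡ-sum; sum-replicate-zero; sum-syntax)
  open SetoidReasoning setoid

  ≈-dec : ∀ x y → Dec (x ≈ y)
  ≈-dec x y with enum-surj x | enum-surj y
  ... | i , ei | j , ej with i ≟ j
  ... | yes ≡.refl = yes (trans (sym ei) ej)
  ... | no i≢j     = no λ x≈y → i≢j (enum-inj i j (trans ei (trans x≈y (sym ej))))

  ∑≡sum : ∀ {n} (f : Fin n → Carrier) → ∑ F f ≡ sum f
  ∑≡sum {zero}  f = ≡.refl
  ∑≡sum {suc n} f = ≡.cong (f zero +_) (∑≡sum (f ∘ suc))

  ∑ℕ≡sum : ∀ n (f : ℕ → Carrier) → ∑ℕ F n f ≡ sum {n} (f ∘ toℕ)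
  ∑ℕ≡sum zero    f = ≡.refl
  ∑ℕ≡sum (suc n) f = ≡.cong (f 0 +_) (∑ℕ≡sum n (f ∘ suc))

  Exhaustible : {A : Set} → (A → A → Set) → Set₁
  Exhaustible {A} _~_ =
    ∀ {P : A → Set} → (∀ {x y} → x ~ y → P x → P y) → Decidable P → Dec (∃ P)

  Carrier-exhaustible : Exhaustible _≈_
  Carrier-exhaustible {P} resp P? with any? (P? ∘ enum)
  ... | yes (i , p) = yes (enum i , p)
  ... | no ∄i = no λ (x , px) → let i , ei = enum-surj x in ∄i (i , resp (sym ei) px)

  Π-exhaustible : {A : Set} {_~_ : A → A → Set} → (∀ {x} → x ~ x) → Exhaustible _~_ →
                  ∀ n → Exhaustible {Fin n → A} (λ f g → ∀ i → f i ~ g i)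
  Π-exhaustible r ex zero {P} resp P? with P? (λ ())
  ... | yes p = yes (_ , p)
  ... | no ¬p = no λ (f , pf) → ¬p (resp (λ ()) pf)
  Π-exhaustible r ex (suc n) {P} resp P?
    with ex {λ a → ∃ λ g → P (a ∷ g)}
            (λ a~b (g , p) → g , resp (λ { zero → a~b ; (suc i) → r }) p)
            (λ a → Π-exhaustible r ex n (λ g~h → resp λ { zero → r ; (suc i) → g~h i }) (P? ∘ (a ∷_)))
  ... | yes (a , g , p) = yes (a ∷ g , p)
  ... | no ∄a = no λ (f , pf) → ∄a (f zero , f ∘ suc , resp (λ { zero → r ; (suc i) → r }) pf)

  Vect-exhaustible : ∀ s m → Exhaustible (_≋V_ F {s} {m})
  Vect-exhaustible s m = Π-exhaustible (λ _ → refl) (Π-exhaustible refl Carrier-exhaustible m) s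

  ⟨_,_⟩ : ∀ {s m} → Vect F s m → Vect F s m → Carrier
  ⟨_,_⟩ {s} {m} v g = ∑[ i < s ] (∑[ t < m ] (v i t * g i t))

  module _ {s m : ℕ} (g : Vect F s m) where

    ⟨⟩-cong : ∀ {v w} → _≋V_ F v w → ⟨ v , g ⟩ ≈ ⟨ w , g ⟩
    ⟨⟩-cong v≋w = sum-cong-≋ λ i → sum-cong-≋ λ t → *-congʳ (v≋w i t)

    ⟨⟩-⊕ : ∀ v w → ⟨ _⊕_ F v w , g ⟩ ≈ ⟨ v , g ⟩ + ⟨ w , g ⟩
    ⟨⟩-⊕ v w = begin
      ⟨ _⊕_ F v w , g ⟩                                            ≈⟨ sum-cong-≋ {s} (λ i → sum-cong-≋ {m} λ t → distribʳ _ _ _) ⟩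
      ∑[ i < s ] (∑[ t < m ] (v i t * g i t + w i t * g i t))      ≈⟨ sum-cong-≋ {s} (λ i → ∑-distrib-+ {m} _ _) ⟩
      ∑[ i < s ] (∑[ t < m ] (v i t * g i t) + ∑[ t < m ] (w i t * g i t)) ≈⟨ ∑-distrib-+ {s} _ _ ⟩
      ⟨ v , g ⟩ + ⟨ w , g ⟩                                        ∎

    ⟨⟩-⊙ : ∀ a v → ⟨ _⊙_ F a v , g ⟩ ≈ a * ⟨ v , g ⟩
    ⟨⟩-⊙ a v = begin
      ⟨ _⊙_ F a v , g ⟩                                ≈⟨ sum-cong-≋ {s} (λ i → sum-cong-≋ {m} λ t → *-assoc _ _ _) ⟩
      ∑[ i < s ] (∑[ t < m ] (a * (v i t * g i t)))    ≈⟨ sum-cong-≋ {s} (λ i → sym (*-distribˡ-sum {m} a _)) ⟩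
      ∑[ i < s ] (a * ∑[ t < m ] (v i t * g i t))      ≈⟨ sym (*-distribˡ-sum {s} a _) ⟩
      a * ⟨ v , g ⟩                                    ∎

    ⟨⟩-⊖ : ∀ v w → ⟨ _⊖_ F v w , g ⟩ ≈ ⟨ v , g ⟩ - ⟨ w , g ⟩
    ⟨⟩-⊖ v w = begin
      ⟨ _⊖_ F v w , g ⟩                          ≈⟨ ⟨⟩-cong (λ i t → +-congˡ (sym (-1*x≈-x _))) ⟩
      ⟨ _⊕_ F v (_⊙_ F (- 1#) w) , g ⟩           ≈⟨ trans (⟨⟩-⊕ v _) (+-congˡ (⟨⟩-⊙ (- 1#) w)) ⟩
      ⟨ v , g ⟩ + - 1# * ⟨ w , g ⟩               ≈⟨ +-congˡ (-1*x≈-x _) ⟩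
      ⟨ v , g ⟩ - ⟨ w , g ⟩                      ∎

    ⟨⟩-zeroV : ⟨ zeroV F , g ⟩ ≈ 0#
    ⟨⟩-zeroV = trans (sum-cong-≋ λ i → trans (sum-cong-≋ λ t → zeroˡ (g i t)) (sum-replicate-zero m))
                     (sum-replicate-zero s)

    ⟨⟩-∑V : ∀ {d} (w : Fin d → Vect F s m) → ⟨ ∑V F w , g ⟩ ≈ ∑[ j < d ] ⟨ w j , g ⟩
    ⟨⟩-∑V {zero}  w = ⟨⟩-zeroV
    ⟨⟩-∑V {suc d} w = trans (⟨⟩-⊕ (w zero) _) (+-congˡ (⟨⟩-∑V (w ∘ suc)))

  module _ {s m : ℕ} where

    IsSubspace-resp : {V W : Subset F s m} → _⊆_ F V W → _⊆_ F W V → IsSubspace F V → IsSubspace F W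
    IsSubspace-resp V⊆W W⊆V (resp , V0 , V+ , V*) =
        (λ v w v≋w Wv → V⊆W w (resp v w v≋w (W⊆V v Wv)))
      , V⊆W _ V0
      , (λ v w Wv Ww → V⊆W _ (V+ v w (W⊆V v Wv) (W⊆V w Ww)))
      , (λ a v Wv → V⊆W _ (V* a v (W⊆V v Wv)))

    ⊖-closed : {K : Subset F s m} → IsSubspace F K → ∀ {v w} → K v → K w → K (_⊖_ F v w)
    ⊖-closed (resp , _ , K+ , K*) Kv Kw =
      resp _ _ (λ i t → +-congˡ (-1*x≈-x _)) (K+ _ _ Kv (K* (- 1#) _ Kw))

    ∑V-closed : {K : Subset F s m} → IsSubspace F K → ∀ {d} {w : Fin d → Vect F s m} →
                (∀ j → K (w j)) → (c : Fin d → Carrier) → K (∑V F (λ j → _⊙_ F (c j) (w j)))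
    ∑V-closed (_ , K0 , _ , _) {zero}  Kw c = K0
    ∑V-closed K@(_ , _ , K+ , K*) {suc d} Kw c =
      K+ _ _ (K* (c zero) _ (Kw zero)) (∑V-closed K (Kw ∘ suc) (c ∘ suc))

    QuotDim≤-resp : ∀ {V V′ W W′ : Subset F s m} {d} → _⊆_ F V′ V → _⊆_ F V V′ → _⊆_ F W W′ →
                    QuotDim≤ F V W d → QuotDim≤ F V′ W′ d
    QuotDim≤-resp V′⊆V V⊆V′ W⊆W′ (w , Vw , span) =
      w , (λ j → V⊆V′ _ (Vw j)) , λ v V′v → let c , Wr = span v (V′⊆V v V′v) in c , W⊆W′ _ Wr

    QuotDim≤-suc : ∀ {V W U : Subset F s m} {d} → (∀ v w → _≋V_ F v w → U v → U w) → _⊆_ F W V →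
                   QuotDim≤ F V W d → QuotDim≤ F W U 1 → QuotDim≤ F V U (suc d)
    QuotDim≤-suc {V} {U = U} U-resp W⊆V (w , Vw , spanW) (u , Wu , spanU) = u zero ∷ w , V-family , span
      where
      V-family : ∀ j → V ((u zero ∷ w) j)
      V-family zero    = W⊆V _ (Wu zero)
      V-family (suc j) = Vw j
      regroup : ∀ x y z → (x - y) - (z + 0#) ≈ x - (z + y)
      regroup x y z = begin
        (x - y) - (z + 0#)  ≈⟨ +-congˡ (-‿cong (+-identityʳ z)) ⟩
        (x - y) - z         ≈⟨ +-assoc x (- y) (- z) ⟩
        x + (- y - z)       ≈⟨ +-congˡ (+-comm (- y) (- z)) ⟩
        x + (- z - y)       ≈⟨ +-congˡ (⁻¹-∙-comm z y) ⟩
        x - (z + y)         ∎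
      span : ∀ v → V v → ∃ λ c → U (_⊖_ F v (∑V F (λ j → _⊙_ F (c j) ((u zero ∷ w) j))))
      span v Vv with spanW v Vv
      ... | c , Wr with spanU _ Wr
      ... | c′ , Ur = c′ zero ∷ c , U-resp _ _ (λ i t → regroup _ _ _) Ur

    ⟨⟩-residual : ∀ (g v : Vect F s m) {d} (c : Fin d → Carrier) (w : Fin d → Vect F s m) →
                  ⟨ _⊖_ F v (∑V F (λ j → _⊙_ F (c j) (w j))) , g ⟩ ≈ ⟨ v , g ⟩ - ∑[ j < d ] (c j * ⟨ w j , g ⟩)
    ⟨⟩-residual g v {d} c w = begin
      ⟨ _⊖_ F v (∑V F (λ j → _⊙_ F (c j) (w j))) , g ⟩  ≈⟨ ⟨⟩-⊖ g v _ ⟩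
      ⟨ v , g ⟩ - ⟨ ∑V F (λ j → _⊙_ F (c j) (w j)) , g ⟩  ≈⟨ +-congˡ (-‿cong (⟨⟩-∑V g {d} _)) ⟩
      ⟨ v , g ⟩ - ∑[ j < d ] ⟨ _⊙_ F (c j) (w j) , g ⟩    ≈⟨ +-congˡ (-‿cong (sum-cong-≋ {d} λ j → ⟨⟩-⊙ g (c j) (w j))) ⟩
      ⟨ v , g ⟩ - ∑[ j < d ] (c j * ⟨ w j , g ⟩)          ∎

    kernel-quotDim≤1-via : {K : Subset F s m} → IsSubspace F K → (g w : Vect F s m) → K w →
                          (c : Vect F s m → Carrier) → (∀ v → K v → ⟨ v , g ⟩ ≈ c v * ⟨ w , g ⟩) →
                          QuotDim≤ F K (λ v → K v × ⟨ v , g ⟩ ≈ 0#) 1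
    kernel-quotDim≤1-via K-sub g w Kw c gv≈c·gw =
      (λ _ → w) , (λ _ → Kw) , λ v Kv → (λ _ → c v) ,
        ⊖-closed K-sub Kv (∑V-closed K-sub {1} (λ _ → Kw) (λ _ → c v)) ,
        trans (⟨⟩-residual g v {1} (λ _ → c v) (λ _ → w))
              (trans (+-congˡ (-‿cong (trans (+-identityʳ _) (sym (gv≈c·gw v Kv))))) (-‿inverseʳ _))

    -- The case split on whether g vanishes on K is where the finiteness of the field is used.
    kernel-quotDim≤1 : {K : Subset F s m} → IsSubspace F K → Decidable K → (g : Vect F s m) →
                       QuotDim≤ F K (λ v → K v × ⟨ v , g ⟩ ≈ 0#) 1
    kernel-quotDim≤1 {K} K-sub@(K-resp , K0 , _) K? g
      with Vect-exhaustible s m {λ w → K w × ¬ ⟨ w , g ⟩ ≈ 0#}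
             (λ w≋w′ (Kw , gw≉0) → K-resp _ _ w≋w′ Kw , λ gw′≈0 → gw≉0 (trans (⟨⟩-cong g w≋w′) gw′≈0))
             (λ w → K? w ×-dec ¬? (≈-dec _ _))
    ... | yes (w , Kw , gw≉0) = let y , y*gw≈1 = inverse _ gw≉0 in
      kernel-quotDim≤1-via K-sub g w Kw (λ v → ⟨ v , g ⟩ * y) λ v _ → sym (begin
        ⟨ v , g ⟩ * y * ⟨ w , g ⟩   ≈⟨ *-assoc _ _ _ ⟩
        ⟨ v , g ⟩ * (y * ⟨ w , g ⟩) ≈⟨ *-congˡ y*gw≈1 ⟩
        ⟨ v , g ⟩ * 1#              ≈⟨ *-identityʳ _ ⟩
        ⟨ v , g ⟩                   ∎)
    ... | no ∄w = kernel-quotDim≤1-via K-sub g (zeroV F) K0 (λ _ → 0#) λ v Kv →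
      trans (decidable-stable (≈-dec _ _) (λ gv≉0 → ∄w (v , Kv , gv≉0))) (sym (zeroˡ _))

  Ann : ∀ {s m} → (ℕ → Vect F s m) → ℕ → Subset F s m
  Ann γ n v = ∀ {j} → j < n → ⟨ v , γ j ⟩ ≈ 0#

  module _ {s m : ℕ} (γ : ℕ → Vect F s m) where

    Ann-isSubspace : ∀ n → IsSubspace F (Ann γ n)
    Ann-isSubspace n =
        (λ v w v≋w γv≈0 j<n → trans (sym (⟨⟩-cong (γ _) v≋w)) (γv≈0 j<n))
      , (λ _ → ⟨⟩-zeroV (γ _))
      , (λ v w γv≈0 γw≈0 j<n → trans (⟨⟩-⊕ (γ _) v w) (trans (+-cong (γv≈0 j<n) (γw≈0 j<n)) (+-identityʳ 0#)))
      , (λ a v γv≈0 j<n → trans (⟨⟩-⊙ (γ _) a v) (trans (*-congˡ (γv≈0 j<n)) (zeroʳ a)))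

    Ann-dec : ∀ n → Decidable (Ann γ n)
    Ann-dec n v = allUpTo? (λ j → ≈-dec ⟨ v , γ j ⟩ 0#) n

    Ann-suc⁻ : ∀ n → _⊆_ F (Ann γ (suc n)) (Ann γ n)
    Ann-suc⁻ n v γv≈0 j<n = γv≈0 (m<n⇒m<1+n j<n)

    Ann-suc⁺ : ∀ n → _⊆_ F (λ v → Ann γ n v × ⟨ v , γ n ⟩ ≈ 0#) (Ann γ (suc n))
    Ann-suc⁺ n v (γv≈0 , γₙv≈0) j<1+n with m<1+n⇒m<n∨m≡n j<1+n
    ... | inj₁ j<n    = γv≈0 j<n
    ... | inj₂ ≡.refl = γₙv≈0

    Ann-quotDim≤1 : ∀ n → QuotDim≤ F (Ann γ n) (Ann γ (suc n)) 1
    Ann-quotDim≤1 n = QuotDim≤-resp (λ _ → id) (λ _ → id) (Ann-suc⁺ n)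
                      (kernel-quotDim≤1 (Ann-isSubspace n) (Ann-dec n) (γ n))

    Ann-codim≤ : ∀ n → QuotDim≤ F (λ _ → ⊤) (Ann γ n) n
    Ann-codim≤ zero    = (λ ()) , (λ ()) , λ _ _ → (λ ()) , λ ()
    Ann-codim≤ (suc n) = QuotDim≤-suc (proj₁ (Ann-isSubspace (suc n))) (λ _ _ → tt)
                          (Ann-codim≤ n) (Ann-quotDim≤1 n)

  -- mulP F f g t unfolds to mulCoeff (coeff F f) (coeff F g) (toℕ t).
  mulCoeff : PowerSeries F → PowerSeries F → ℕ → Carrier
  mulCoeff f g n = ∑ℕ F (suc n) (λ l → f l * g (n ∸ l))

  mulCoeff-cong : ∀ {f f′ g g′ : PowerSeries F} n → (∀ {l} → l ≤ n → f l ≈ f′ l) →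
                  (∀ {l} → l ≤ n → g l ≈ g′ l) → mulCoeff f g n ≈ mulCoeff f′ g′ n
  mulCoeff-cong {f} {f′} {g} {g′} n f≈f′ g≈g′ = begin
    mulCoeff f g n                                    ≡⟨ ∑ℕ≡sum (suc n) (λ l → f l * g (n ∸ l)) ⟩
    ∑[ l < suc n ] (f (toℕ l) * g (n ∸ toℕ l))       ≈⟨ sum-cong-≋ {suc n} (λ l → *-cong (f≈f′ (l≤n l)) (g≈g′ (m∸n≤m n (toℕ l)))) ⟩
    ∑[ l < suc n ] (f′ (toℕ l) * g′ (n ∸ toℕ l))     ≡⟨ ∑ℕ≡sum (suc n) (λ l → f′ l * g′ (n ∸ l)) ⟨
    mulCoeff f′ g′ n                                  ∎
    where
    l≤n : (l : Fin (suc n)) → toℕ l ≤ n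
    l≤n l = ≤-pred (toℕ<n l)

  mulCoeff-linearʳ : ∀ (f : PowerSeries F) {d} (c : Fin d → Carrier) (h : Fin d → PowerSeries F) n →
                     mulCoeff f (λ k → ∑[ j < d ] (c j * h j k)) n ≈ ∑[ j < d ] (c j * mulCoeff f (h j) n)
  mulCoeff-linearʳ f {d} c h n = begin
    mulCoeff f (λ k → ∑[ j < d ] (c j * h j k)) n       ≡⟨ ∑ℕ≡sum (suc n) (λ l → f l * ∑[ j < d ] (c j * h j (n ∸ l))) ⟩
    ∑[ l < suc n ] (f (toℕ l) * ∑[ j < d ] (c j * hₙ j l)) ≈⟨ sum-cong-≋ {suc n} (λ l → trans (*-distribˡ-sum {d} (f (toℕ l)) _)
                                                               (sum-cong-≋ {d} λ j → x∙yz≈y∙xz (f (toℕ l)) (c j) (hₙ j l))) ⟩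
    ∑[ l < suc n ] (∑[ j < d ] (c j * term j l))         ≈⟨ ∑-comm {suc n} {d} (λ l j → c j * term j l) ⟩
    ∑[ j < d ] (∑[ l < suc n ] (c j * term j l))         ≈⟨ sum-cong-≋ {d} (λ j → sym (*-distribˡ-sum {suc n} (c j) (term j))) ⟩
    ∑[ j < d ] (c j * ∑[ l < suc n ] term j l)           ≈⟨ sum-cong-≋ {d} (λ j → *-congˡ (reflexive (≡.sym (∑ℕ≡sum (suc n) (λ l → f l * h j (n ∸ l)))))) ⟩
    ∑[ j < d ] (c j * mulCoeff f (h j) n)                ∎
    where
    hₙ : Fin d → Fin (suc n) → Carrier
    hₙ j l = h j (n ∸ toℕ l)
    term : Fin d → Fin (suc n) → Carrier
    term j l = f (toℕ l) * hₙ j l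

  module _ {m : ℕ} where

    coeff-at : (f : Poly F m) {n : ℕ} (t : Fin m) → toℕ t ≡ n → coeff F f n ≈ f t
    coeff-at f {n} t ≡.refl with n <? m
    ... | yes n<m = reflexive (≡.cong f (toℕ-injective (toℕ-fromℕ< n<m)))
    ... | no n≮m  = ⊥-elim (n≮m (toℕ<n t))

    coeff-< : (f : Poly F m) {n : ℕ} (n<m : n < m) → coeff F f n ≈ f (fromℕ< n<m)
    coeff-< f n<m = coeff-at f (fromℕ< n<m) (toℕ-fromℕ< n<m)

    coeff-≥ : (f : Poly F m) {n : ℕ} → ¬ n < m → coeff F f n ≈ 0#
    coeff-≥ f {n} n≮m with n <? m
    ... | yes n<m = ⊥-elim (n≮m n<m)
    ... | no _    = refl

    coeff-cong : {f g : Poly F m} → _≋_ F f g → ∀ n → coeff F f n ≈ coeff F g n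
    coeff-cong {f} {g} f≋g n with n <? m
    ... | yes n<m = f≋g (fromℕ< n<m)
    ... | no _    = refl

    coeff-red : ∀ (α : PowerSeries F) {n} → n < m → coeff F (red F m α) n ≈ α n
    coeff-red α n<m = trans (coeff-< (red F m α) n<m) (reflexive (≡.cong α (toℕ-fromℕ< n<m)))

    coeff-lincomb : ∀ {d} (c : Fin d → Carrier) (b : Fin d → Poly F m) n →
                    coeff F (lincomb F c b) n ≈ ∑[ j < d ] (c j * coeff F (b j) n)
    coeff-lincomb {d} c b n with n <? m
    ... | yes n<m = reflexive (∑≡sum (λ j → c j * b j (fromℕ< n<m)))
    ... | no _    = sym (trans (sum-cong-≋ {d} λ j → zeroʳ (c j)) (sum-replicate-zero d))

  coeff-suc : ∀ {m} (f : Poly F (suc m)) n → coeff F {m} (f ∘ suc) n ≈ coeff F f (suc n)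
  coeff-suc {m} f n with n <? m
  ... | yes n<m = sym (coeff-at f (suc (fromℕ< n<m)) (≡.cong suc (toℕ-fromℕ< n<m)))
  ... | no n≮m  = sym (coeff-≥ f (n≮m ∘ ≤-pred))

  pad-toℕ : ∀ {m} (f : Poly F m) (t : Fin (suc m)) → pad F f t ≈ coeff F f (toℕ t)
  pad-toℕ {zero}  f zero    = sym (coeff-≥ f {0} λ ())
  pad-toℕ {suc m} f zero    = sym (coeff-at f zero ≡.refl)
  pad-toℕ {suc m} f (suc t) = trans (pad-toℕ (f ∘ suc) t) (coeff-suc f (toℕ t))

  coeff-pad : ∀ {m} (f : Poly F m) n → coeff F (pad F f) n ≈ coeff F f n
  coeff-pad {m} f n with n <? suc m
  ... | yes n<1+m = trans (pad-toℕ f (fromℕ< n<1+m)) (reflexive (≡.cong (coeff F f) (toℕ-fromℕ< n<1+m)))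
  ... | no n≮1+m  = sym (coeff-≥ f (n≮1+m ∘ m<n⇒m<1+n))

  pad-sum : ∀ {m} (c : Fin m → Carrier) (g : Fin (suc m) → Carrier) →
            ∑[ j < suc m ] (pad F c j * g j) ≈ ∑[ j < m ] (c j * g (inj₁F F j))
  pad-sum {zero}  c g = trans (+-identityʳ _) (zeroˡ (g zero))
  pad-sum {suc m} c g = +-congˡ (pad-sum (c ∘ suc) (g ∘ suc))

  module _ {s : ℕ} (B : BasisFamily F s) (α : Fin s → PowerSeries F) where

    productCoeff : (m : ℕ) → ℕ → Vect F s m
    productCoeff m n i j = mulCoeff (α i) (coeff F (B m i j)) n

    dotP≈⟨⟩ : ∀ {m} {k : Fin s → Poly F m} {v : Vect F s m} → θ≡ F B m k v →
              ∀ t → dotP F m α k t ≈ ⟨ v , productCoeff m (toℕ t) ⟩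
    dotP≈⟨⟩ {m} {k} {v} θkv t = begin
      dotP F m α k t                                                   ≡⟨ ∑≡sum (λ i → mulP F (red F m (α i)) (k i) t) ⟩
      ∑[ i < s ] mulCoeff (coeff F (red F m (α i))) (coeff F (k i)) n  ≈⟨ sum-cong-≋ {s} (λ i → mulCoeff-cong n
                                                                            (λ l≤n → coeff-red (α i) (≤-<-trans l≤n (toℕ<n t)))
                                                                            (λ {l} _ → coordinates i l)) ⟩
      ∑[ i < s ] mulCoeff (α i) (λ l → ∑[ j < m ] (v i j * coeff F (B m i j) l)) n
                                                                        ≈⟨ sum-cong-≋ {s} (λ i → mulCoeff-linearʳ (α i) (v i) (coeff F ∘ B m i) n) ⟩
      ⟨ v , productCoeff m n ⟩                                          ∎
      where
      n : ℕ
      n = toℕ t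
      coordinates : ∀ i l → coeff F (k i) l ≈ ∑[ j < m ] (v i j * coeff F (B m i j) l)
      coordinates i l = trans (coeff-cong (λ t → sym (θkv i t)) l) (coeff-lincomb (v i) (B m i) l)

    𝒩⊆Ann : ∀ m → _⊆_ F (𝒩 F B α m) (Ann (productCoeff m) m)
    𝒩⊆Ann m v (k , αk≈0 , θkv) {n} n<m =
      ≡.subst (λ n → ⟨ v , productCoeff m n ⟩ ≈ 0#) (toℕ-fromℕ< n<m)
              (trans (sym (dotP≈⟨⟩ θkv (fromℕ< n<m))) (αk≈0 (fromℕ< n<m)))

    Ann⊆𝒩 : ∀ m → _⊆_ F (Ann (productCoeff m) m) (𝒩 F B α m)
    Ann⊆𝒩 m v v⊥ = (λ i → lincomb F (v i) (B m i)) , (λ t → trans (dotP≈⟨⟩ (λ _ _ → refl) t) (v⊥ (toℕ<n t)))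
                 , λ _ _ → refl

    module _ (compatible : ∀ m i j t → B (suc m) i (inj₁F F j) t ≈ pad F (B m i j) t) where

      ⟨⟩-pad : ∀ {m} (v : Vect F s m) n → ⟨ (λ i → pad F (v i)) , productCoeff (suc m) n ⟩ ≈ ⟨ v , productCoeff m n ⟩
      ⟨⟩-pad {m} v n = sum-cong-≋ {s} λ i → trans (pad-sum (v i) (productCoeff (suc m) n i))
        (sum-cong-≋ {m} λ j → *-congˡ (mulCoeff-cong {α i} n (λ _ → refl)
          (λ {l} _ → trans (coeff-cong (compatible m i j) l) (coeff-pad (B m i j) l))))

      restrict⊆Ann : ∀ m → _⊆_ F (restrict F (𝒩 F B α (suc m))) (Ann (productCoeff m) (suc m))
      restrict⊆Ann m v pad-v∈𝒩 {j} j<1+m = trans (sym (⟨⟩-pad v j)) (𝒩⊆Ann (suc m) (λ i → pad F (v i)) pad-v∈𝒩 j<1+m)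

      Ann⊆restrict : ∀ m → _⊆_ F (Ann (productCoeff m) (suc m)) (restrict F (𝒩 F B α (suc m)))
      Ann⊆restrict m v v⊥ = Ann⊆𝒩 (suc m) (λ i → pad F (v i)) λ {j} j<1+m → trans (⟨⟩-pad v j) (v⊥ j<1+m)

theorem5 : {q : ℕ} (F : FiniteField q) (s : ℕ) → 2 ≤ s →
    (B : BasisFamily F s) → AdmissibleBases F B →
    (α : Fin s → PowerSeries F) → (∀ i → InY F (α i)) →
    IsDualSpaceChain F (𝒩 F B α)
theorem5 F s _ B (_ , compatible) α _ m =
    IsSubspace-resp (Ann⊆𝒩 B α M) (𝒩⊆Ann B α M) (Ann-isSubspace γ M)
  , QuotDim≤-resp (λ _ → id) (λ _ → id) (Ann⊆𝒩 B α M) (Ann-codim≤ γ M)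
  , (λ v pad-v∈𝒩 → Ann⊆𝒩 B α M v (Ann-suc⁻ γ M v (restrict⊆Ann B α compatible M v pad-v∈𝒩)))
  , QuotDim≤-resp (𝒩⊆Ann B α M) (Ann⊆𝒩 B α M) (Ann⊆restrict B α compatible M) (Ann-quotDim≤1 γ M)
  where
  open Over F
  M : ℕ
  M = suc m
  γ : ℕ → Vect F s M
  γ = productCoeff B α M
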